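{- Let $G=(V,E)$ be a hypergraph and $U\subseteq V$. Then \[ I(G,x)=I(G_{ -U},x)+\sum_{\substack{\emptyset\neq W\subseteq U\\ W\text{ is independent in } G}}(-1)^{|W|+1}\,x^{|W|}\cdot I(G_{\div W},x). \]
   Context: A hypergraph $G=(V,E)$ consists of a finite vertex set $V$ and a finite multiset $E$ of non-empty subsets of $V$ (edges). A set $W\subseteq V$ is independent in $G$ if no edge $e\in E$ satisfies $e\subseteq W$. The independence polynomial is $I(G,x)=\sum_{W\subseteq V,\ W\text{ independent}}x^{|W|}$. $G_{ -U}$ is obtained by deleting the vertices of $U$ together with all edges containing at least one of them. For $W\subseteq V$ containing no edge, $G_{\div W}$ ("hiding" $W$) is the hypergraph with vertex set $V\setminus W$ and edge multiset $\{e\setminus W: e\in E\}$. -}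

module Defs where

open import Data.Nat using (ℕ; zero; suc)
open import Data.Bool using (Bool; true; false)
open import Data.List using (List; []; _∷_; map; filter; _++_)
open import Data.List.Relation.Unary.All using (All)
import Data.List.Relation.Unary.All as All
open import Data.Vec using (Vec; []; _∷_)
open import Data.Fin.Subset using (Subset; _⊆_; _─_; _∩_; ∣_∣; Nonempty; Empty)
open import Data.Fin.Subset.Properties using (_⊆?_; nonempty?)
open import Data.Product using (_×_)
open import Relation.Nullary using (¬_; Dec; yes; no)
open import Relation.Nullary.Decidable using (_×-dec_; ¬?)
open import Algebra.Bundles using (CommutativeRing)

record Hypergraph (n : ℕ) : Set where
  constructor hypergraph
  field
    V : Subset n
    E : List (Subset n)
open Hypergraph public

WellFormed : ∀ {n} → Hypergraph n → Set
WellFormed G = All (λ e → Nonempty e × e ⊆ V G) (E G)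

Independent : ∀ {n} → Hypergraph n → Subset n → Set
Independent G W = W ⊆ V G × All (λ e → ¬ (e ⊆ W)) (E G)

independent? : ∀ {n} (G : Hypergraph n) (W : Subset n) → Dec (Independent G W)
independent? G W = (W ⊆? V G) ×-dec All.all? (λ e → ¬? (e ⊆? W)) (E G)

deleteV : ∀ {n} → Hypergraph n → Subset n → Hypergraph n
deleteV G U = hypergraph (V G ─ U) (filter (λ e → ¬? (nonempty? (e ∩ U))) (E G))

hide : ∀ {n} → Hypergraph n → Subset n → Hypergraph n
hide G W = hypergraph (V G ─ W) (map (λ e → e ─ W) (E G))

allSubsets : ∀ n → List (Subset n)
allSubsets zero = [] ∷ []
allSubsets (suc n) = map (false ∷_) (allSubsets n) ++ map (true ∷_) (allSubsets n)

module _ {c ℓ} (R : CommutativeRing c ℓ) where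
  open CommutativeRing R

  pow : Carrier → ℕ → Carrier
  pow x zero = 1#
  pow x (suc k) = x * pow x k

  sumR : ∀ {A : Set} → (A → Carrier) → List A → Carrier
  sumR f [] = 0#
  sumR f (a ∷ as) = f a + sumR f as

  indepPoly : ∀ {n} → Hypergraph n → Carrier → Carrier
  indepPoly {n} G x = sumR (λ W → pow x ∣ W ∣) (filter (independent? G) (allSubsets n))

  indepNonemptySubsetsOf : ∀ {n} → Hypergraph n → Subset n → List (Subset n)
  indepNonemptySubsetsOf {n} G U =
    filter (λ W → (W ⊆? U) ×-dec (nonempty? W ×-dec independent? G W)) (allSubsets n)

  expansionRHS : ∀ {n} → Hypergraph n → Subset n → Carrier → Carrier
  expansionRHS G U x =
    indepPoly (deleteV G U) x
      + sumR (λ W → pow (- 1#) (suc ∣ W ∣) * pow x ∣ W ∣ * indepPoly (hide G W) x)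
             (indepNonemptySubsetsOf G U)

-- Write I(G, x) as the sum of x^|T| over the independent sets T of G and split it
-- according to whether T meets U. The sets T disjoint from U are exactly the independent
-- sets of G_{-U}. For T meeting U, insert 1 = Σ_{∅ ≠ W ⊆ T ∩ U} (-1)^{|W|+1} and exchange
-- the summations, writing T = W ⊎ S: given W ⊆ T, the set T is independent in G iff W is
-- independent in G and S = T ∖ W is independent in G_{÷W}, and x^|T| = x^|W| x^|S|.
-- Sums over filtered lists of subsets are turned into sums over all subsets weighted by a
-- Boolean indicator (guard), so that exchanging the summations becomes a reindexing of a
-- double sum over all pairs of subsets.

module Submission where

open import Defs
open import Data.Nat using (ℕ; zero; suc)
import Data.Nat as ℕ
open import Data.Nat.Properties using (+-suc)
open import Data.Bool using (Bool; true; false; _∧_; not)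
open import Data.Bool.Properties using (∧-identityʳ)
open import Data.List using (List; []; _∷_; map; filter; _++_)
import Data.List.Relation.Unary.All as All
open import Data.List.Relation.Unary.All.Properties using (map⁺; map⁻; filter⁺; filter⁻; all-filter)
open import Data.Vec using ([]; _∷_; here; there)
open import Data.Fin using (Fin; zero; suc)
open import Data.Fin.Subset
  using (Subset; inside; outside; _∈_; _∉_; _⊆_; _─_; _∩_; ∁; ∣_∣; Nonempty; Empty)
open import Data.Fin.Subset.Properties
  using (_⊆?_; nonempty?; _∈?_; drop-∷-⊆; drop-there; ⊆-trans; p─q⊆p; x∈p∧x∉q⇒x∈p─q;
         x∈p∩q⁺; x∈p∩q⁻; x∉p⇒x∈∁p)
open import Data.Product using (_×_; _,_; proj₁; proj₂)
open import Function using (_∘_)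
open import Relation.Unary using (Decidable)
open import Function.Bundles using (_⇔_; mk⇔; module Equivalence)
open import Relation.Nullary using (¬_; Dec; yes; no; does; ¬?; _×-dec_; contradiction)
open import Relation.Nullary.Decidable using (does-⇔; dec-true)
open import Relation.Binary.PropositionalEquality as ≡ using (_≡_)
open import Algebra.Bundles using (CommutativeRing)

private
  variable
    n : ℕ
    p q r : Subset n

x∈p─q⇒x∉q : ∀ {x : Fin n} (p q : Subset n) → x ∈ p ─ q → x ∉ q
x∈p─q⇒x∉q (inside ∷ p) (outside ∷ q) here ()
x∈p─q⇒x∉q (_ ∷ p) (_ ∷ q) (there x∈p─q) (there x∈q) = x∈p─q⇒x∉q p q x∈p─q x∈q

─-monoˡ-⊆ : p ⊆ q → p ─ r ⊆ q ─ r
─-monoˡ-⊆ {p = p} {r = r} p⊆q x∈p─r =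
  x∈p∧x∉q⇒x∈p─q (p⊆q (p─q⊆p p r x∈p─r)) (x∈p─q⇒x∉q p r x∈p─r)

─-cancelˡ-⊆ : r ⊆ q → p ─ r ⊆ q ─ r → p ⊆ q
─-cancelˡ-⊆ {r = r} {q = q} r⊆q p─r⊆q─r {x} x∈p with x ∈? r
... | yes x∈r = r⊆q x∈r
... | no  x∉r = p─q⊆p q r (p─r⊆q─r (x∈p∧x∉q⇒x∈p─q x∈p x∉r))

⊆-─⇔ : p ⊆ q ─ r ⇔ (p ⊆ q × Empty (p ∩ r))
⊆-─⇔ {p = p} {q = q} {r = r} = mk⇔ to from
  where
  to : p ⊆ q ─ r → p ⊆ q × Empty (p ∩ r)
  to p⊆q─r = p─q⊆p q r ∘ p⊆q─r , λ (_ , x∈p∩r) →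
    let x∈p , x∈r = x∈p∩q⁻ p r x∈p∩r in x∈p─q⇒x∉q q r (p⊆q─r x∈p) x∈r
  from : p ⊆ q × Empty (p ∩ r) → p ⊆ q ─ r
  from (p⊆q , p∩r=∅) x∈p = x∈p∧x∉q⇒x∈p─q (p⊆q x∈p) (λ x∈r → p∩r=∅ (_ , x∈p∩q⁺ (x∈p , x∈r)))

⊆-∩⇔ : p ⊆ q ∩ r ⇔ (p ⊆ q × p ⊆ r)
⊆-∩⇔ {p = p} {q = q} {r = r} = mk⇔ to from
  where
  to : p ⊆ q ∩ r → p ⊆ q × p ⊆ r
  to p⊆q∩r = proj₁ ∘ x∈p∩q⁻ q r ∘ p⊆q∩r , proj₂ ∘ x∈p∩q⁻ q r ∘ p⊆q∩r
  from : p ⊆ q × p ⊆ r → p ⊆ q ∩ r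
  from (p⊆q , p⊆r) x∈p = x∈p∩q⁺ (p⊆q x∈p , p⊆r x∈p)

⊆-─⇒⊆∁ : p ⊆ q ─ r → p ⊆ ∁ r
⊆-─⇒⊆∁ {q = q} {r = r} p⊆q─r = x∉p⇒x∈∁p ∘ x∈p─q⇒x∉q q r ∘ p⊆q─r

∩-nonempty-monoˡ : p ⊆ q → Nonempty (p ∩ r) → Nonempty (q ∩ r)
∩-nonempty-monoˡ {p = p} {r = r} p⊆q (x , x∈p∩r) =
  let x∈p , x∈r = x∈p∩q⁻ p r x∈p∩r in x , x∈p∩q⁺ (p⊆q x∈p , x∈r)

∣p∣+∣q─p∣≡∣q∣ : p ⊆ q → ∣ p ∣ ℕ.+ ∣ q ─ p ∣ ≡ ∣ q ∣
∣p∣+∣q─p∣≡∣q∣ {p = []}          {q = []}          _   = ≡.refl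
∣p∣+∣q─p∣≡∣q∣ {p = inside ∷ p}  {q = inside ∷ q}  p⊆q = ≡.cong suc (∣p∣+∣q─p∣≡∣q∣ (drop-∷-⊆ p⊆q))
∣p∣+∣q─p∣≡∣q∣ {p = inside ∷ p}  {q = outside ∷ q} p⊆q = contradiction (p⊆q here) λ ()
∣p∣+∣q─p∣≡∣q∣ {p = outside ∷ p} {q = inside ∷ q}  p⊆q =
  ≡.trans (+-suc ∣ p ∣ ∣ q ─ p ∣) (≡.cong suc (∣p∣+∣q─p∣≡∣q∣ (drop-∷-⊆ p⊆q)))
∣p∣+∣q─p∣≡∣q∣ {p = outside ∷ p} {q = outside ∷ q} p⊆q = ∣p∣+∣q─p∣≡∣q∣ (drop-∷-⊆ p⊆q)

does-⊆?-∩ : (p q r : Subset n) → does (p ⊆? q ∩ r) ≡ does (p ⊆? q) ∧ does (p ⊆? r)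
does-⊆?-∩ p q r = does-⇔ ⊆-∩⇔ (p ⊆? q ∩ r) ((p ⊆? q) ×-dec (p ⊆? r))

does-nonempty?-outside : (p : Subset n) → does (nonempty? (outside ∷ p)) ≡ does (nonempty? p)
does-nonempty?-outside p = does-⇔
  (mk⇔ (λ { (zero , ()) ; (suc x , x∈p) → x , drop-there x∈p }) (λ (x , x∈p) → suc x , there x∈p))
  (nonempty? (outside ∷ p)) (nonempty? p)

module _ {G : Hypergraph n} where

  Independent-antitone : p ⊆ q → Independent G q → Independent G p
  Independent-antitone {p = p} {q = q} p⊆q (q⊆V , q-free) = ⊆-trans p⊆q q⊆V , All.map ⊈-antitone q-free
    where
    ⊈-antitone : ∀ {e} → ¬ e ⊆ q → ¬ e ⊆ p
    ⊈-antitone e⊈q e⊆p = e⊈q (⊆-trans e⊆p p⊆q)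

  Independent-deleteV⇔ : Independent (deleteV G r) p ⇔ (Independent G p × Empty (p ∩ r))
  Independent-deleteV⇔ {r = r} {p = p} = mk⇔ to from
    where
    meets? : (e : Subset n) → Dec (¬ Nonempty (e ∩ r))
    meets? e = ¬? (nonempty? (e ∩ r))
    to : Independent (deleteV G r) p → Independent G p × Empty (p ∩ r)
    to (p⊆V─r , p-free) =
      (proj₁ (Equivalence.to ⊆-─⇔ p⊆V─r) , filter⁻ meets? p-free (All.map meeting⇒⊈ (all-filter (¬? ∘ meets?) (E G)))) , p∩r=∅
      where
      p∩r=∅ : Empty (p ∩ r)
      p∩r=∅ = proj₂ (Equivalence.to ⊆-─⇔ p⊆V─r)
      meeting⇒⊈ : ∀ {e} → ¬ ¬ Nonempty (e ∩ r) → ¬ e ⊆ p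
      meeting⇒⊈ e∩r≠∅ e⊆p = e∩r≠∅ (p∩r=∅ ∘ ∩-nonempty-monoˡ e⊆p)
    from : Independent G p × Empty (p ∩ r) → Independent (deleteV G r) p
    from ((p⊆V , p-free) , p∩r=∅) = Equivalence.from ⊆-─⇔ (p⊆V , p∩r=∅) , filter⁺ meets? p-free

  Independent-hide⇔ : p ⊆ q → (Independent G p × Independent (hide G p) (q ─ p)) ⇔ Independent G q
  Independent-hide⇔ {p = p} {q = q} p⊆q = mk⇔ to from
    where
    to : Independent G p × Independent (hide G p) (q ─ p) → Independent G q
    to ((p⊆V , _) , (q─p⊆V─p , q─p-free)) =
      ─-cancelˡ-⊆ p⊆V q─p⊆V─p , All.map ⊈-q─p⇒⊈-q (map⁻ q─p-free)
      where
      ⊈-q─p⇒⊈-q : ∀ {e} → ¬ e ─ p ⊆ q ─ p → ¬ e ⊆ q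
      ⊈-q─p⇒⊈-q e─p⊈q─p e⊆q = e─p⊈q─p (─-monoˡ-⊆ e⊆q)
    from : Independent G q → Independent G p × Independent (hide G p) (q ─ p)
    from q-indep@(q⊆V , q-free) =
      Independent-antitone p⊆q q-indep , ─-monoˡ-⊆ q⊆V , map⁺ (All.map ⊈-q⇒⊈-q─p q-free)
      where
      ⊈-q⇒⊈-q─p : ∀ {e} → ¬ e ⊆ q → ¬ e ─ p ⊆ q ─ p
      ⊈-q⇒⊈-q─p e⊈q e─p⊆q─p = e⊈q (─-cancelˡ-⊆ p⊆q e─p⊆q─p)

  Independent-hide⇒⊆∁ : Independent (hide G p) q → q ⊆ ∁ p
  Independent-hide⇒⊆∁ = ⊆-─⇒⊆∁ ∘ proj₁

module _ {c ℓ} (R : CommutativeRing c ℓ) where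
  open CommutativeRing R
  open import Algebra.Properties.Ring ring using (-1*x≈-x; -‿involutive)
  open import Algebra.Properties.CommutativeSemigroup +-commutativeSemigroup using (interchange)
  open import Relation.Binary.Reasoning.Setoid setoid

  private
    variable
      A : Set

  guard : Bool → Carrier → Carrier
  guard true  y = y
  guard false _ = 0#

  guard-0# : ∀ b → guard b 0# ≡ 0#
  guard-0# true  = ≡.refl
  guard-0# false = ≡.refl

  guard-cong : ∀ b {y z} → y ≈ z → guard b y ≈ guard b z
  guard-cong true  y≈z = y≈z
  guard-cong false _   = refl

  guard-comm : ∀ a b y → guard a (guard b y) ≡ guard b (guard a y)
  guard-comm true  b y = ≡.refl
  guard-comm false b y = ≡.sym (guard-0# b)

  guard-∧ : ∀ a b y → guard (a ∧ b) y ≡ guard a (guard b y)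
  guard-∧ true  b y = ≡.refl
  guard-∧ false b y = ≡.refl

  guard-∧-assoc : ∀ a b d y → guard (a ∧ (b ∧ d)) y ≡ guard (a ∧ b) (guard d y)
  guard-∧-assoc true  b d y = guard-∧ b d y
  guard-∧-assoc false b d y = ≡.refl

  *-guard : ∀ b k y → k * guard b y ≈ guard b (k * y)
  *-guard true  k y = refl
  *-guard false k y = zeroʳ k

  guard-*-guard : ∀ a b y → guard a (y * guard b 1#) ≈ guard (a ∧ b) y
  guard-*-guard false b     y = refl
  guard-*-guard true  true  y = *-identityʳ y
  guard-*-guard true  false y = zeroʳ y

  guard-split : ∀ a b y → guard (a ∧ not b) y + guard (a ∧ b) y ≈ guard a y
  guard-split false b     y = +-identityʳ 0#
  guard-split true  true  y = +-identityˡ y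
  guard-split true  false y = +-identityʳ y

  guard-excluded-middle : ∀ b → guard b 1# + guard (not b) 1# ≈ 1#
  guard-excluded-middle true  = +-identityʳ 1#
  guard-excluded-middle false = +-identityˡ 1#

  guard-implied : ∀ {P Q : Set} (P? : Dec P) (Q? : Dec Q) → (P → Q) → ∀ y →
                  guard (does P?) y ≡ guard (does Q?) (guard (does P?) y)
  guard-implied (yes p) Q? P⇒Q y = ≡.cong (λ b → guard b y) (≡.sym (dec-true Q? (P⇒Q p)))
  guard-implied (no _)  Q? P⇒Q y = ≡.sym (guard-0# (does Q?))

  ∑ : (A → Carrier) → List A → Carrier
  ∑ = sumR R

  ∑-cong : ∀ {f g : A → Carrier} xs → (∀ a → f a ≈ g a) → ∑ f xs ≈ ∑ g xs
  ∑-cong []       f≈g = refl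
  ∑-cong (a ∷ xs) f≈g = +-cong (f≈g a) (∑-cong xs f≈g)

  ∑-++ : ∀ (f : A → Carrier) xs ys → ∑ f (xs ++ ys) ≈ ∑ f xs + ∑ f ys
  ∑-++ f []       ys = sym (+-identityˡ _)
  ∑-++ f (a ∷ xs) ys = trans (+-cong refl (∑-++ f xs ys)) (sym (+-assoc _ _ _))

  ∑-map : ∀ {B : Set} (f : B → Carrier) (g : A → B) xs → ∑ f (map g xs) ≡ ∑ (f ∘ g) xs
  ∑-map f g []       = ≡.refl
  ∑-map f g (a ∷ xs) = ≡.cong (f (g a) +_) (∑-map f g xs)

  ∑-0# : ∀ (xs : List A) → ∑ (λ _ → 0#) xs ≈ 0#
  ∑-0# []       = refl
  ∑-0# (a ∷ xs) = trans (+-identityˡ _) (∑-0# xs)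

  ∑-+ : ∀ (f g : A → Carrier) xs → ∑ (λ a → f a + g a) xs ≈ ∑ f xs + ∑ g xs
  ∑-+ f g []       = sym (+-identityˡ 0#)
  ∑-+ f g (a ∷ xs) =
    trans (+-cong refl (∑-+ f g xs)) (interchange (f a) (g a) (∑ f xs) (∑ g xs))

  *-∑ : ∀ k (f : A → Carrier) xs → k * ∑ f xs ≈ ∑ (λ a → k * f a) xs
  *-∑ k f []       = zeroʳ k
  *-∑ k f (a ∷ xs) = trans (distribˡ k _ _) (+-cong refl (*-∑ k f xs))

  guard-∑ : ∀ b (f : A → Carrier) xs → guard b (∑ f xs) ≈ ∑ (λ a → guard b (f a)) xs
  guard-∑ true  f xs = refl
  guard-∑ false f xs = sym (∑-0# xs)

  ∑-filter : ∀ {P : A → Set} (P? : Decidable P) (f : A → Carrier) xs →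
             ∑ f (filter P? xs) ≈ ∑ (λ a → guard (does (P? a)) (f a)) xs
  ∑-filter P? f []       = refl
  ∑-filter P? f (a ∷ xs) with does (P? a)
  ... | true  = +-cong refl (∑-filter P? f xs)
  ... | false = trans (∑-filter P? f xs) (sym (+-identityˡ _))

  ∑ₛ : (Subset n → Carrier) → Carrier
  ∑ₛ {n} f = ∑ f (allSubsets n)

  ∑ₛ-0# : ∑ₛ {n} (λ _ → 0#) ≈ 0#
  ∑ₛ-0# {n} = ∑-0# (allSubsets n)

  ∑ₛ-∷ : (f : Subset (suc n) → Carrier) → ∑ₛ f ≈ ∑ₛ (f ∘ (outside ∷_)) + ∑ₛ (f ∘ (inside ∷_))
  ∑ₛ-∷ {n} f = trans (∑-++ f (map (outside ∷_) (allSubsets n)) (map (inside ∷_) (allSubsets n)))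
    (+-cong (reflexive (∑-map f (outside ∷_) (allSubsets n)))
            (reflexive (∑-map f (inside ∷_) (allSubsets n))))

  ∑ₛ²-∷ : (g : Subset (suc n) → Subset (suc n) → Carrier) →
    ∑ₛ (λ W → ∑ₛ (g W)) ≈
      (∑ₛ (λ W → ∑ₛ (λ S → g (outside ∷ W) (outside ∷ S))) + ∑ₛ (λ W → ∑ₛ (λ S → g (outside ∷ W) (inside ∷ S))))
      + (∑ₛ (λ W → ∑ₛ (λ S → g (inside ∷ W) (outside ∷ S))) + ∑ₛ (λ W → ∑ₛ (λ S → g (inside ∷ W) (inside ∷ S))))
  ∑ₛ²-∷ {n} g = trans (∑ₛ-∷ (λ W → ∑ₛ (g W)))
    (+-cong (split-inner outside) (split-inner inside))
    where
    split-inner : ∀ b → ∑ₛ (λ W → ∑ₛ (g (b ∷ W))) ≈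
      ∑ₛ (λ W → ∑ₛ (λ S → g (b ∷ W) (outside ∷ S))) + ∑ₛ (λ W → ∑ₛ (λ S → g (b ∷ W) (inside ∷ S)))
    split-inner b = trans (∑-cong (allSubsets n) (λ W → ∑ₛ-∷ (g (b ∷ W)))) (∑-+ _ _ (allSubsets n))

  -- Both sides sum over the pairs of disjoint subsets, matched by (W , S) ↦ (W ∪ S , W).
  ∑ₛ-disjoint≈∑ₛ-⊆ : (f : Subset n → Subset n → Carrier) →
    ∑ₛ (λ W → ∑ₛ (λ S → guard (does (S ⊆? ∁ W)) (f W S))) ≈
    ∑ₛ (λ T → ∑ₛ (λ W → guard (does (W ⊆? T)) (f W (T ─ W))))
  ∑ₛ-disjoint≈∑ₛ-⊆ {zero}  f = refl
  -- On the left the block with inside ∷ W and inside ∷ S vanishes, on the right the block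
  -- with outside ∷ T and inside ∷ W; the other three blocks match by recursion.
  ∑ₛ-disjoint≈∑ₛ-⊆ {suc n} f = begin
    ∑ₛ (λ W → ∑ₛ (λ S → guard (does (S ⊆? ∁ W)) (f W S)))
      ≈⟨ ∑ₛ²-∷ {n} _ ⟩
    (∑ₛ (λ W → ∑ₛ (λ S → guard (does (S ⊆? ∁ W)) (f (outside ∷ W) (outside ∷ S))))
      + ∑ₛ (λ W → ∑ₛ (λ S → guard (does (S ⊆? ∁ W)) (f (outside ∷ W) (inside ∷ S)))))
    + (∑ₛ (λ W → ∑ₛ (λ S → guard (does (S ⊆? ∁ W)) (f (inside ∷ W) (outside ∷ S))))
      + ∑ₛ {n} (λ W → ∑ₛ {n} (λ S → 0#)))
      ≈⟨ +-cong (+-cong (recurse outside outside) (recurse outside inside))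
                (+-cong (recurse inside outside) zeros) ⟩
    (b₀₀ + b₀₁) + (b₁₀ + 0#)
      ≈⟨ +-cong refl (+-identityʳ _) ⟩
    (b₀₀ + b₀₁) + b₁₀
      ≈⟨ +-assoc _ _ _ ⟩
    b₀₀ + (b₀₁ + b₁₀)
      ≈⟨ +-cong (sym (trans (+-cong refl zeros) (+-identityʳ _))) refl ⟩
    (b₀₀ + ∑ₛ {n} (λ T → ∑ₛ {n} (λ W → 0#))) + (b₀₁ + b₁₀)
      ≈⟨ sym (∑ₛ²-∷ {n} _) ⟩
    ∑ₛ (λ T → ∑ₛ (λ W → guard (does (W ⊆? T)) (f W (T ─ W)))) ∎
    where
    b : Bool → Bool → Carrier
    b w s = ∑ₛ (λ T → ∑ₛ (λ W → guard (does (W ⊆? T)) (f (w ∷ W) (s ∷ (T ─ W)))))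
    b₀₀ b₀₁ b₁₀ : Carrier
    b₀₀ = b outside outside
    b₀₁ = b outside inside
    b₁₀ = b inside outside
    recurse : ∀ w s → ∑ₛ (λ W → ∑ₛ (λ S → guard (does (S ⊆? ∁ W)) (f (w ∷ W) (s ∷ S)))) ≈ b w s
    recurse w s = ∑ₛ-disjoint≈∑ₛ-⊆ (λ W S → f (w ∷ W) (s ∷ S))
    zeros : ∑ₛ {n} (λ W → ∑ₛ {n} (λ S → 0#)) ≈ 0#
    zeros = trans (∑-cong (allSubsets n) (λ _ → ∑ₛ-0# {n})) (∑ₛ-0# {n})

  pow-+ : ∀ y a b → pow R y (a ℕ.+ b) ≈ pow R y a * pow R y b
  pow-+ y zero    b = sym (*-identityˡ _)
  pow-+ y (suc a) b = trans (*-cong refl (pow-+ y a b)) (sym (*-assoc _ _ _))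

  -1*-1*x≈x : ∀ y → - 1# * (- 1# * y) ≈ y
  -1*-1*x≈x y = trans (-1*x≈-x _) (trans (-‿cong (-1*x≈-x y)) (-‿involutive y))

  alternatingSum : (A : Subset n) →
    ∑ₛ (λ W → guard (does (W ⊆? A)) (pow R (- 1#) ∣ W ∣)) ≈ guard (not (does (nonempty? A))) 1#
  alternatingSum {zero}  []           = +-identityʳ 1#
  alternatingSum {suc n} (outside ∷ A) = begin
    ∑ₛ (λ W → guard (does (W ⊆? outside ∷ A)) (pow R (- 1#) ∣ W ∣))
      ≈⟨ ∑ₛ-∷ {n} _ ⟩
    ∑ₛ (λ W → guard (does (W ⊆? A)) (pow R (- 1#) ∣ W ∣)) + ∑ₛ {n} (λ _ → 0#)
      ≈⟨ +-cong (alternatingSum A) (∑ₛ-0# {n}) ⟩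
    guard (not (does (nonempty? A))) 1# + 0#
      ≈⟨ +-identityʳ _ ⟩
    guard (not (does (nonempty? A))) 1#
      ≡⟨ ≡.cong (λ b → guard (not b) 1#) (≡.sym (does-nonempty?-outside A)) ⟩
    guard (not (does (nonempty? (outside ∷ A)))) 1# ∎
  alternatingSum {suc n} (inside ∷ A) = begin
    ∑ₛ (λ W → guard (does (W ⊆? inside ∷ A)) (pow R (- 1#) ∣ W ∣))
      ≈⟨ ∑ₛ-∷ {n} _ ⟩
    s + ∑ₛ (λ W → guard (does (W ⊆? A)) (- 1# * pow R (- 1#) ∣ W ∣))
      ≈⟨ +-cong refl (∑-cong (allSubsets n) (λ W → sym (*-guard (does (W ⊆? A)) (- 1#) _))) ⟩
    s + ∑ₛ (λ W → - 1# * guard (does (W ⊆? A)) (pow R (- 1#) ∣ W ∣))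
      ≈⟨ +-cong refl (sym (*-∑ (- 1#) _ (allSubsets n))) ⟩
    s + - 1# * s
      ≈⟨ +-cong refl (-1*x≈-x s) ⟩
    s + - s
      ≈⟨ -‿inverseʳ s ⟩
    0# ∎
    where
    s : Carrier
    s = ∑ₛ (λ W → guard (does (W ⊆? A)) (pow R (- 1#) ∣ W ∣))

  private
    guard-∧-nonempty?-outside : (A : Subset n) → ∀ W →
      guard (does (W ⊆? A) ∧ does (nonempty? (outside ∷ W))) (pow R (- 1#) (suc ∣ W ∣))
        ≈ guard (does (W ⊆? A) ∧ does (nonempty? W)) (pow R (- 1#) (suc ∣ W ∣))
    guard-∧-nonempty?-outside A W =
      reflexive (≡.cong (λ b → guard (does (W ⊆? A) ∧ b) (pow R (- 1#) (suc ∣ W ∣))) (does-nonempty?-outside W))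

  alternatingSum-nonempty : (A : Subset n) →
    ∑ₛ (λ W → guard (does (W ⊆? A) ∧ does (nonempty? W)) (pow R (- 1#) (suc ∣ W ∣)))
      ≈ guard (does (nonempty? A)) 1#
  alternatingSum-nonempty {zero}  []           = +-identityʳ 0#
  alternatingSum-nonempty {suc n} (outside ∷ A) = begin
    ∑ₛ (λ W → guard (does (W ⊆? outside ∷ A) ∧ does (nonempty? W)) (pow R (- 1#) (suc ∣ W ∣)))
      ≈⟨ ∑ₛ-∷ {n} _ ⟩
    ∑ₛ (λ W → guard (does (W ⊆? A) ∧ does (nonempty? (outside ∷ W))) (pow R (- 1#) (suc ∣ W ∣)))
      + ∑ₛ {n} (λ _ → 0#)
      ≈⟨ +-cong (∑-cong (allSubsets n) (guard-∧-nonempty?-outside A)) (∑ₛ-0# {n}) ⟩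
    ∑ₛ (λ W → guard (does (W ⊆? A) ∧ does (nonempty? W)) (pow R (- 1#) (suc ∣ W ∣))) + 0#
      ≈⟨ trans (+-identityʳ _) (alternatingSum-nonempty A) ⟩
    guard (does (nonempty? A)) 1#
      ≡⟨ ≡.cong (λ b → guard b 1#) (≡.sym (does-nonempty?-outside A)) ⟩
    guard (does (nonempty? (outside ∷ A))) 1# ∎
  alternatingSum-nonempty {suc n} (inside ∷ A) = begin
    ∑ₛ (λ W → guard (does (W ⊆? inside ∷ A) ∧ does (nonempty? W)) (pow R (- 1#) (suc ∣ W ∣)))
      ≈⟨ ∑ₛ-∷ {n} _ ⟩
    ∑ₛ (λ W → guard (does (W ⊆? A) ∧ does (nonempty? (outside ∷ W))) (pow R (- 1#) (suc ∣ W ∣)))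
      + ∑ₛ (λ W → guard (does (W ⊆? A) ∧ true) (- 1# * (- 1# * pow R (- 1#) ∣ W ∣)))
      ≈⟨ +-cong (∑-cong (allSubsets n) (guard-∧-nonempty?-outside A)) (∑-cong (allSubsets n) drop-inside) ⟩
    ∑ₛ (λ W → guard (does (W ⊆? A) ∧ does (nonempty? W)) (pow R (- 1#) (suc ∣ W ∣)))
      + ∑ₛ (λ W → guard (does (W ⊆? A)) (pow R (- 1#) ∣ W ∣))
      ≈⟨ +-cong (alternatingSum-nonempty A) (alternatingSum A) ⟩
    guard (does (nonempty? A)) 1# + guard (not (does (nonempty? A))) 1#
      ≈⟨ guard-excluded-middle (does (nonempty? A)) ⟩
    1# ∎
    where
    drop-inside : ∀ W → guard (does (W ⊆? A) ∧ true) (- 1# * (- 1# * pow R (- 1#) ∣ W ∣))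
                      ≈ guard (does (W ⊆? A)) (pow R (- 1#) ∣ W ∣)
    drop-inside W = trans (reflexive (≡.cong (λ b → guard b _) (∧-identityʳ (does (W ⊆? A)))))
                          (guard-cong (does (W ⊆? A)) (-1*-1*x≈x _))

  indepPoly-as-∑ₛ : (H : Hypergraph n) (x : Carrier) →
    indepPoly R H x ≈ ∑ₛ (λ T → guard (does (independent? H T)) (pow R x ∣ T ∣))
  indepPoly-as-∑ₛ {n} H x = ∑-filter (independent? H) (λ T → pow R x ∣ T ∣) (allSubsets n)

  module _ (G : Hypergraph n) (U : Subset n) (x : Carrier) where

    indepPoly-deleteV : indepPoly R (deleteV G U) x ≈
      ∑ₛ (λ T → guard (does (independent? G T) ∧ not (does (nonempty? (T ∩ U)))) (pow R x ∣ T ∣))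
    indepPoly-deleteV = trans (indepPoly-as-∑ₛ (deleteV G U) x) (∑-cong (allSubsets n) λ T →
      reflexive (≡.cong (λ b → guard b (pow R x ∣ T ∣))
        (does-⇔ Independent-deleteV⇔ (independent? (deleteV G U) T)
                                     (independent? G T ×-dec ¬? (nonempty? (T ∩ U))))))

    private
      admissible : Subset n → Bool
      admissible W = does (W ⊆? U) ∧ (does (nonempty? W) ∧ does (independent? G W))

      coefficient : Subset n → Carrier
      coefficient W = pow R (- 1#) (suc ∣ W ∣) * pow R x ∣ W ∣

      term : Subset n → Subset n → Carrier
      term W S =
        guard (admissible W) (guard (does (independent? (hide G W) S)) (coefficient W * pow R x ∣ S ∣))

      expand-hidden : ∀ W →
        guard (admissible W) (coefficient W * indepPoly R (hide G W) x)
          ≈ ∑ₛ (λ S → guard (does (S ⊆? ∁ W)) (term W S))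
      expand-hidden W = begin
        guard (admissible W) (coefficient W * indepPoly R (hide G W) x)
          ≈⟨ guard-cong (admissible W) (*-cong refl (indepPoly-as-∑ₛ (hide G W) x)) ⟩
        guard (admissible W) (coefficient W * ∑ₛ (λ S → guard (indHide S) (pow R x ∣ S ∣)))
          ≈⟨ guard-cong (admissible W) (*-∑ (coefficient W) _ (allSubsets n)) ⟩
        guard (admissible W) (∑ₛ (λ S → coefficient W * guard (indHide S) (pow R x ∣ S ∣)))
          ≈⟨ guard-∑ (admissible W) _ (allSubsets n) ⟩
        ∑ₛ (λ S → guard (admissible W) (coefficient W * guard (indHide S) (pow R x ∣ S ∣)))
          ≈⟨ ∑-cong (allSubsets n) (λ S →
               guard-cong (admissible W) (*-guard (indHide S) (coefficient W) (pow R x ∣ S ∣))) ⟩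
        ∑ₛ (term W)
          ≈⟨ ∑-cong (allSubsets n) (λ S → reflexive (only-disjoint S)) ⟩
        ∑ₛ (λ S → guard (does (S ⊆? ∁ W)) (term W S)) ∎
        where
        indHide : Subset n → Bool
        indHide S = does (independent? (hide G W) S)
        only-disjoint : ∀ S → term W S ≡ guard (does (S ⊆? ∁ W)) (term W S)
        only-disjoint S = ≡.trans
          (≡.cong (guard (admissible W))
            (guard-implied (independent? (hide G W) S) (S ⊆? ∁ W) Independent-hide⇒⊆∁ y))
          (guard-comm (admissible W) (does (S ⊆? ∁ W)) (guard (indHide S) y))
          where
          y : Carrier
          y = coefficient W * pow R x ∣ S ∣

      coefficient-shift : ∀ {W T} → W ⊆ T →
        coefficient W * pow R x ∣ T ─ W ∣ ≈ pow R x ∣ T ∣ * pow R (- 1#) (suc ∣ W ∣)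
      coefficient-shift {W} {T} W⊆T = begin
        pow R (- 1#) (suc ∣ W ∣) * pow R x ∣ W ∣ * pow R x ∣ T ─ W ∣
          ≈⟨ *-assoc _ _ _ ⟩
        pow R (- 1#) (suc ∣ W ∣) * (pow R x ∣ W ∣ * pow R x ∣ T ─ W ∣)
          ≈⟨ *-cong refl (sym (pow-+ x ∣ W ∣ ∣ T ─ W ∣)) ⟩
        pow R (- 1#) (suc ∣ W ∣) * pow R x (∣ W ∣ ℕ.+ ∣ T ─ W ∣)
          ≡⟨ ≡.cong (λ k → pow R (- 1#) (suc ∣ W ∣) * pow R x k) (∣p∣+∣q─p∣≡∣q∣ W⊆T) ⟩
        pow R (- 1#) (suc ∣ W ∣) * pow R x ∣ T ∣
          ≈⟨ *-comm _ _ ⟩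
        pow R x ∣ T ∣ * pow R (- 1#) (suc ∣ W ∣) ∎

      regroup : ∀ T W → guard (does (W ⊆? T)) (term W (T ─ W)) ≈
        guard (does (independent? G T))
          (pow R x ∣ T ∣ * guard (does (W ⊆? T ∩ U) ∧ does (nonempty? W)) (pow R (- 1#) (suc ∣ W ∣)))
      regroup T W rewrite does-⊆?-∩ W T U with W ⊆? T
      ... | no _ = sym (trans (guard-cong (does (independent? G T)) (zeroʳ _))
                              (reflexive (guard-0# (does (independent? G T)))))
      ... | yes W⊆T = begin
        guard (sU ∧ (nz ∧ indW)) (guard indT─W (coefficient W * pow R x ∣ T ─ W ∣))
          ≡⟨ guard-∧-assoc sU nz indW _ ⟩
        guard (sU ∧ nz) (guard indW (guard indT─W (coefficient W * pow R x ∣ T ─ W ∣)))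
          ≡⟨ ≡.cong (guard (sU ∧ nz)) (≡.sym (guard-∧ indW indT─W _)) ⟩
        guard (sU ∧ nz) (guard (indW ∧ indT─W) (coefficient W * pow R x ∣ T ─ W ∣))
          ≡⟨ ≡.cong (λ b → guard (sU ∧ nz) (guard b (coefficient W * pow R x ∣ T ─ W ∣)))
                    (does-⇔ (Independent-hide⇔ W⊆T)
                            (independent? G W ×-dec independent? (hide G W) (T ─ W)) (independent? G T)) ⟩
        guard (sU ∧ nz) (guard indT (coefficient W * pow R x ∣ T ─ W ∣))
          ≈⟨ guard-cong (sU ∧ nz) (guard-cong indT (coefficient-shift W⊆T)) ⟩
        guard (sU ∧ nz) (guard indT (pow R x ∣ T ∣ * pow R (- 1#) (suc ∣ W ∣)))
          ≡⟨ guard-comm (sU ∧ nz) indT _ ⟩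
        guard indT (guard (sU ∧ nz) (pow R x ∣ T ∣ * pow R (- 1#) (suc ∣ W ∣)))
          ≈⟨ guard-cong indT (sym (*-guard (sU ∧ nz) _ _)) ⟩
        guard indT (pow R x ∣ T ∣ * guard (sU ∧ nz) (pow R (- 1#) (suc ∣ W ∣))) ∎
        where
        sU nz indW indT─W indT : Bool
        sU = does (W ⊆? U)
        nz = does (nonempty? W)
        indW = does (independent? G W)
        indT─W = does (independent? (hide G W) (T ─ W))
        indT = does (independent? G T)

      collapse : ∀ T →
        ∑ₛ (λ W → guard (does (independent? G T))
                    (pow R x ∣ T ∣ * guard (does (W ⊆? T ∩ U) ∧ does (nonempty? W)) (pow R (- 1#) (suc ∣ W ∣))))
          ≈ guard (does (independent? G T) ∧ does (nonempty? (T ∩ U))) (pow R x ∣ T ∣)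
      collapse T = begin
        ∑ₛ (λ W → guard indT (pow R x ∣ T ∣ * alternating W))
          ≈⟨ sym (guard-∑ indT _ (allSubsets n)) ⟩
        guard indT (∑ₛ (λ W → pow R x ∣ T ∣ * alternating W))
          ≈⟨ guard-cong indT (sym (*-∑ (pow R x ∣ T ∣) alternating (allSubsets n))) ⟩
        guard indT (pow R x ∣ T ∣ * ∑ₛ alternating)
          ≈⟨ guard-cong indT (*-cong refl (alternatingSum-nonempty (T ∩ U))) ⟩
        guard indT (pow R x ∣ T ∣ * guard (does (nonempty? (T ∩ U))) 1#)
          ≈⟨ guard-*-guard indT (does (nonempty? (T ∩ U))) (pow R x ∣ T ∣) ⟩
        guard (indT ∧ does (nonempty? (T ∩ U))) (pow R x ∣ T ∣) ∎
        where
        indT : Bool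
        indT = does (independent? G T)
        alternating : Subset n → Carrier
        alternating W = guard (does (W ⊆? T ∩ U) ∧ does (nonempty? W)) (pow R (- 1#) (suc ∣ W ∣))

    expansion-∑ :
      ∑ (λ W → pow R (- 1#) (suc ∣ W ∣) * pow R x ∣ W ∣ * indepPoly R (hide G W) x) (indepNonemptySubsetsOf R G U)
        ≈ ∑ₛ (λ T → guard (does (independent? G T) ∧ does (nonempty? (T ∩ U))) (pow R x ∣ T ∣))
    expansion-∑ = begin
      ∑ (λ W → coefficient W * indepPoly R (hide G W) x) (indepNonemptySubsetsOf R G U)
        ≈⟨ ∑-filter _ _ (allSubsets n) ⟩
      ∑ₛ (λ W → guard (admissible W) (coefficient W * indepPoly R (hide G W) x))
        ≈⟨ ∑-cong (allSubsets n) expand-hidden ⟩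
      ∑ₛ (λ W → ∑ₛ (λ S → guard (does (S ⊆? ∁ W)) (term W S)))
        ≈⟨ ∑ₛ-disjoint≈∑ₛ-⊆ term ⟩
      ∑ₛ (λ T → ∑ₛ (λ W → guard (does (W ⊆? T)) (term W (T ─ W))))
        ≈⟨ ∑-cong (allSubsets n) (λ T → ∑-cong (allSubsets n) (regroup T)) ⟩
      ∑ₛ (λ T → ∑ₛ (λ W → guard (does (independent? G T))
          (pow R x ∣ T ∣ * guard (does (W ⊆? T ∩ U) ∧ does (nonempty? W)) (pow R (- 1#) (suc ∣ W ∣)))))
        ≈⟨ ∑-cong (allSubsets n) collapse ⟩
      ∑ₛ (λ T → guard (does (independent? G T) ∧ does (nonempty? (T ∩ U))) (pow R x ∣ T ∣)) ∎

-- The identity holds for every edge list and every U ⊆ Fin n.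
mainTheorem5 : ∀ {c ℓ} (R : CommutativeRing c ℓ) {n : ℕ} (G : Hypergraph n) (U : Subset n) →
    WellFormed G → U ⊆ V G → (x : CommutativeRing.Carrier R) →
    CommutativeRing._≈_ R (indepPoly R G x) (expansionRHS R G U x)
mainTheorem5 R {n} G U _ _ x = begin
  indepPoly R G x
    ≈⟨ indepPoly-as-∑ₛ R G x ⟩
  ∑ₛ R (λ T → guard R (ind T) (pow R x ∣ T ∣))
    ≈⟨ ∑-cong R (allSubsets n) (λ T → sym (guard-split R (ind T) (meets T) (pow R x ∣ T ∣))) ⟩
  ∑ₛ R (λ T → guard R (ind T ∧ not (meets T)) (pow R x ∣ T ∣) + guard R (ind T ∧ meets T) (pow R x ∣ T ∣))
    ≈⟨ ∑-+ R _ _ (allSubsets n) ⟩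
  ∑ₛ R (λ T → guard R (ind T ∧ not (meets T)) (pow R x ∣ T ∣)) + ∑ₛ R (λ T → guard R (ind T ∧ meets T) (pow R x ∣ T ∣))
    ≈⟨ +-cong (sym (indepPoly-deleteV R G U x)) (sym (expansion-∑ R G U x)) ⟩
  expansionRHS R G U x ∎
  where
  open CommutativeRing R
  open import Relation.Binary.Reasoning.Setoid setoid
  ind meets : Subset n → Bool
  ind T = does (independent? G T)
  meets T = does (nonempty? (T ∩ U))
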